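{- Let $M\in\Lambda$ and $A\in\mathcal A$. (1) If $A\sqsubseteq M$ then $\mathcal T^{\mathrm{nf}}(A)\subseteq\mathrm{NF}(\mathcal T(M))$. (2) If $\mathcal T^{\mathrm{nf}}(A)\subseteq\mathcal T^{\mathrm{nf}}(\mathrm{BT}(M))$ then $A\in\mathcal A(M)$.
   Context: Call-by-value $\lambda$-calculus: $\Lambda$ is the set of $\lambda$-terms $M::=x\mid\lambda x.M\mid MN$ up to $\alpha$-conversion; values are variables and abstractions. Reductions: $(\beta_v)$ $(\lambda x.M)V\to M\{V/x\}$ for $V$ a value; $(\sigma_1)$ $(\lambda x.M)NP\to(\lambda x.MP)N$ if $x\notin FV(P)$; $(\sigma_3)$ $V((\lambda x.M)N)\to(\lambda x.VM)N$ if $V$ value, $x\notin FV(V)$; $\to_{\mathsf v}$ is the contextual closure of their union, $\twoheadrightarrow_{\mathsf v}$ its reflexive-transitive closure. $\Lambda_\bot$: $\lambda$-terms possibly containing a constant $\bot$; $\sqsubseteq$ is the context-closed preorder generated by $\bot\sqsubseteq x$, $\bot\sqsubseteq\lambda x.M$. Approximants $\mathcal A$: $A::=B\mid C$; $B::=x\mid\lambda x.A\mid\bot\mid xBA_1\cdots A_k$; $C::=(\lambda x.A)(yBA_1\cdots A_k)$ ($k\ge0$). $\mathcal A(M)=\{A\in\mathcal A\mid\exists N,\ M\twoheadrightarrow_{\mathsf v}N,\ A\sqsubseteq N\}$. Resource calculus: resource values $v::=x\mid\lambda x.t$; simple terms $s,t::=st\mid[v_1,\dots,v_k]$ ($k\ge0$,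 finite multisets); $[x^n]$ is the bag of $n$ copies of $x$. Reduction $\to_{\mathsf r}$ on finite sets: contextual (multilinear) closure of $(\beta_r)$ $[\lambda x.t][v_1,\dots,v_n]\to$ the set of terms obtained by substituting the $v_i$ bijectively for the free occurrences of $x$ in $t$ if there are exactly $n$ of them, $\emptyset$ otherwise; $(0)$ $[v_1,\dots,v_n]t\to\emptyset$ for $n\neq1$; $(\sigma_1)$ $[\lambda x.t]s_1s_2\to[\lambda x.ts_2]s_1$ ($x\notin FV(s_1)$); $(\sigma_3)$ $[v]([\lambda x.t]s)\to[\lambda x.[v]t]s$ ($x\notin FV(v)$). It is confluent and strongly normalizing; $\mathrm{NF}(\mathbb E)$ is the union over $e\in\mathbb E$ of the normal form of $\{e\}$. Taylor expansion: $\mathcal T(x)=\{[x^n]\mid n\ge0\}$, $\mathcal T(\lambda x.N)=\{[\lambda x.t_1,\dots,\lambda x.t_n]\mid n\ge0,\ t_i\in\mathcal T(N)\}$, $\mathcal T(PQ)=\{st\mid s\in\mathcal T(P),t\in\mathcal T(Q)\}$. Normalized Taylor expansion of approximants: $\mathcal T^{\mathrm{nf}}(x)=\{[x^n]\mid n\ge0\}$; $\mathcal T^{\mathrm{nf}}(\lambda x.A')=\{[\lambda x.t_1,\dots,\lambda x.t_n]\mid n\ge0,t_i\in\mathcal T^{\mathrm{nf}}(A')\}$; $\mathcal T^{\mathrm{nf}}(\bot)=\{[\,]\}$; $\mathcal T^{\mathrm{nf}}(xBA_1\cdots A_k)=\{[x]t_0t_1\cdots t_k\mid t_0\in\mathcal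 T^{\mathrm{nf}}(B),t_i\in\mathcal T^{\mathrm{nf}}(A_i)\}$; $\mathcal T^{\mathrm{nf}}((\lambda x.A')(yBA_1\cdots A_k))=\{[\lambda x.s]t\mid s\in\mathcal T^{\mathrm{nf}}(A'),t\in\mathcal T^{\mathrm{nf}}(yBA_1\cdots A_k)\}$. Finally $\mathcal T^{\mathrm{nf}}(\mathrm{BT}(M))=\bigcup_{A\in\mathcal A(M)}\mathcal T^{\mathrm{nf}}(A)$. -}

module Defs where

open import Data.Nat using (ℕ; zero; suc; _+_; _∸_; _<_; _≟_)
open import Data.Nat.Properties using (<-cmp)
open import Data.List using (List; []; _∷_; [_]; _++_; map; concatMap; replicate; length; mapMaybe)
open import Data.List.Relation.Unary.All using (All)
open import Data.List.Relation.Unary.Any using (Any)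
open import Data.List.Relation.Binary.Permutation.Propositional using (_↭_)
open import Data.Maybe using (Maybe; just; nothing; _>>=_)
open import Data.Product using (Σ; ∃; ∃-syntax; _×_; _,_)
open import Relation.Binary.PropositionalEquality using (_≡_; _≢_)
open import Relation.Binary.Construct.Closure.ReflexiveTransitive using (Star)
open import Relation.Binary.Definitions using (tri<; tri≈; tri>)
open import Relation.Nullary using (¬_)

-- Conventions: terms use de Bruijn indices (this quotients by α-conversion).
-- Free-variable side conditions of σ-rules become index shifts.

ext : (ℕ → ℕ) → ℕ → ℕ
ext ρ zero    = zero
ext ρ (suc n) = suc (ρ n)

data Λ : Set where
  var : ℕ → Λ
  lam : Λ → Λ
  app : Λ → Λ → Λ

data IsValue : Λ → Set where
  val-var : ∀ {x} → IsValue (var x)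
  val-lam : ∀ {M} → IsValue (lam M)

rename : (ℕ → ℕ) → Λ → Λ
rename ρ (var x)   = var (ρ x)
rename ρ (lam M)   = lam (rename (ext ρ) M)
rename ρ (app M N) = app (rename ρ M) (rename ρ N)

exts : (ℕ → Λ) → ℕ → Λ
exts σ zero    = var zero
exts σ (suc n) = rename suc (σ n)

subst : (ℕ → Λ) → Λ → Λ
subst σ (var x)   = σ x
subst σ (lam M)   = lam (subst (exts σ) M)
subst σ (app M N) = app (subst σ M) (subst σ N)

sub1 : Λ → ℕ → Λ
sub1 V zero    = V
sub1 V (suc n) = var n

-- M{V/x} where x is the variable bound by the outermost λ (index 0)
_⟨_⟩ : Λ → Λ → Λ
M ⟨ V ⟩ = subst (sub1 V) M

infix 4 _→v_ _↠v_

data _→v_ : Λ → Λ → Set where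
  βv   : ∀ {M V} → IsValue V → app (lam M) V →v M ⟨ V ⟩
  σ₁   : ∀ {M N P} → app (app (lam M) N) P →v app (lam (app M (rename suc P))) N
  σ₃   : ∀ {V M N} → IsValue V →
         app V (app (lam M) N) →v app (lam (app (rename suc V) M)) N
  ξlam : ∀ {M M'} → M →v M' → lam M →v lam M'
  ξl   : ∀ {M M' N} → M →v M' → app M N →v app M' N
  ξr   : ∀ {M N N'} → N →v N' → app M N →v app M N'

_↠v_ : Λ → Λ → Set
_↠v_ = Star _→v_

data Λ⊥ : Set where
  var : ℕ → Λ⊥
  lam : Λ⊥ → Λ⊥
  app : Λ⊥ → Λ⊥ → Λ⊥
  bot : Λ⊥

⌜_⌝ : Λ → Λ⊥
⌜ var x ⌝   = var x
⌜ lam M ⌝   = lam ⌜ M ⌝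
⌜ app M N ⌝ = app ⌜ M ⌝ ⌜ N ⌝

infix 4 _⊑_

data _⊑_ : Λ⊥ → Λ⊥ → Set where
  ⊑-refl  : ∀ {M} → M ⊑ M
  ⊑-trans : ∀ {M N P} → M ⊑ N → N ⊑ P → M ⊑ P
  ⊥⊑var   : ∀ {x} → bot ⊑ var x
  ⊥⊑lam   : ∀ {M} → bot ⊑ lam M
  ⊑-lam   : ∀ {M M'} → M ⊑ M' → lam M ⊑ lam M'
  ⊑-app   : ∀ {M M' N N'} → M ⊑ M' → N ⊑ N' → app M N ⊑ app M' N'

-- Approximants
--   A ::= B | C
--   B ::= x | λx.A | ⊥ | x B A₁ ⋯ Aₖ
--   C ::= (λx.A)(y B A₁ ⋯ Aₖ)
-- IsSpine S  means  S = x B A₁ ⋯ Aₖ  (k ≥ 0)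

data IsA : Λ⊥ → Set
data IsB : Λ⊥ → Set
data IsC : Λ⊥ → Set
data IsSpine : Λ⊥ → Set

data IsA where
  A-B : ∀ {t} → IsB t → IsA t
  A-C : ∀ {t} → IsC t → IsA t

data IsB where
  B-var   : ∀ {x} → IsB (var x)
  B-lam   : ∀ {A} → IsA A → IsB (lam A)
  B-bot   : IsB bot
  B-spine : ∀ {S} → IsSpine S → IsB S

data IsSpine where
  sp-base : ∀ {x B} → IsB B → IsSpine (app (var x) B)
  sp-ext  : ∀ {S A} → IsSpine S → IsA A → IsSpine (app S A)

data IsC where
  C-redex : ∀ {A S} → IsA A → IsSpine S → IsC (app (lam A) S)

_∈𝒜_ : Λ⊥ → Λ → Set
A ∈𝒜 M = IsA A × ∃[ N ] (M ↠v N × A ⊑ ⌜ N ⌝)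

data RTm : Set
data RVal : Set

data RTm where
  rapp : RTm → RTm → RTm
  bag  : List RVal → RTm     -- finite multiset, up to permutation (see _≈t_)

data RVal where
  rvar : ℕ → RVal
  rlam : RTm → RVal

renT : (ℕ → ℕ) → RTm → RTm
renB : (ℕ → ℕ) → List RVal → List RVal
renV : (ℕ → ℕ) → RVal → RVal
renT ρ (rapp s t) = rapp (renT ρ s) (renT ρ t)
renT ρ (bag vs)   = bag (renB ρ vs)
renB ρ []         = []
renB ρ (v ∷ vs)   = renV ρ v ∷ renB ρ vs
renV ρ (rvar x)   = rvar (ρ x)
renV ρ (rlam t)   = rlam (renT (ext ρ) t)

infix 4 _≈t_ _≈b_ _≈v_
data _≈t_ : RTm → RTm → Set
data _≈b_ : List RVal → List RVal → Set
data _≈v_ : RVal → RVal → Set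

data _≈t_ where
  ≈-app : ∀ {s s' t t'} → s ≈t s' → t ≈t t' → rapp s t ≈t rapp s' t'
  ≈-bag : ∀ {vs ws} → vs ≈b ws → bag vs ≈t bag ws

data _≈b_ where
  ≈b-nil   : [] ≈b []
  ≈b-cons  : ∀ {v w vs ws} → v ≈v w → vs ≈b ws → (v ∷ vs) ≈b (w ∷ ws)
  ≈b-perm  : ∀ {vs ws} → vs ↭ ws → vs ≈b ws
  ≈b-trans : ∀ {us vs ws} → us ≈b vs → vs ≈b ws → us ≈b ws

data _≈v_ where
  ≈-var : ∀ {x} → rvar x ≈v rvar x
  ≈-lam : ∀ {t t'} → t ≈t t' → rlam t ≈v rlam t'

-- Linear substitution of the values of a list, in order, for the free
-- occurrences of the variable of index d (d = number of binders crossed),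
-- consuming the list; free variables above d are decremented (the binder
-- disappears).
substVar : ℕ → ℕ → List RVal → Maybe (RVal × List RVal)
substVar d x us with <-cmp x d
... | tri< _ _ _ = just (rvar x , us)
... | tri> _ _ _ = just (rvar (x ∸ 1) , us)
... | tri≈ _ _ _ with us
...   | []       = nothing
...   | u ∷ us'  = just (renV (λ k → k + d) u , us')

lsT : ℕ → RTm → List RVal → Maybe (RTm × List RVal)
lsB : ℕ → List RVal → List RVal → Maybe (List RVal × List RVal)
lsV : ℕ → RVal → List RVal → Maybe (RVal × List RVal)
lsT d (rapp s t) us with lsT d s us
... | nothing = nothing
... | just (s' , us₁) with lsT d t us₁
...   | nothing = nothing
...   | just (t' , us₂) = just (rapp s' t' , us₂)
lsT d (bag vs) us with lsB d vs us
... | nothing = nothing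
... | just (vs' , us₁) = just (bag vs' , us₁)
lsB d [] us = just ([] , us)
lsB d (v ∷ vs) us with lsV d v us
... | nothing = nothing
... | just (v' , us₁) with lsB d vs us₁
...   | nothing = nothing
...   | just (vs' , us₂) = just (v' ∷ vs' , us₂)
lsV d (rvar x) us = substVar d x us
lsV d (rlam t) us with lsT (suc d) t us
... | nothing = nothing
... | just (t' , us₁) = just (rlam t' , us₁)

-- succeeds iff the number of occurrences equals the length of the list
linSubst : RTm → List RVal → Maybe RTm
linSubst t us with lsT 0 t us
... | just (t' , []) = just t'
... | _              = nothing

insertions : {A : Set} → A → List A → List (List A)
insertions x []       = [ x ∷ [] ]
insertions x (y ∷ ys) = (x ∷ y ∷ ys) ∷ map (y ∷_) (insertions x ys)

perms : {A : Set} → List A → List (List A)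
perms []       = [ [] ]
perms (x ∷ xs) = concatMap (insertions x) (perms xs)

-- the set of terms obtained by substituting the vᵢ bijectively for the
-- occurrences of x in t (empty if the number of occurrences differs)
βres : RTm → List RVal → List RTm
βres t us = mapMaybe (linSubst t) (perms us)

-- one step t → 𝕋 (𝕋 a finite set, represented by a list)
infix 4 _⟶r_ _⟶s_
data _⟶r_ : RTm → List RTm → Set where
  βr   : ∀ {t us} → rapp (bag [ rlam t ]) (bag us) ⟶r βres t us
  r0   : ∀ {vs t} → length vs ≢ 1 → rapp (bag vs) t ⟶r []
  rσ₁  : ∀ {t s₁ s₂} →
         rapp (rapp (bag [ rlam t ]) s₁) s₂ ⟶r
           [ rapp (bag [ rlam (rapp t (renT suc s₂)) ]) s₁ ]
  rσ₃  : ∀ {v t s} →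
         rapp (bag [ v ]) (rapp (bag [ rlam t ]) s) ⟶r
           [ rapp (bag [ rlam (rapp (bag [ renV suc v ]) t) ]) s ]
  ξl   : ∀ {s t 𝕊} → s ⟶r 𝕊 → rapp s t ⟶r map (λ s' → rapp s' t) 𝕊
  ξr   : ∀ {s t 𝕋} → t ⟶r 𝕋 → rapp s t ⟶r map (rapp s) 𝕋
  ξbag : ∀ {vs ws t 𝕋} → t ⟶r 𝕋 →
         bag (vs ++ rlam t ∷ ws) ⟶r map (λ t' → bag (vs ++ rlam t' ∷ ws)) 𝕋

-- reduction on finite sets of simple terms (lists; duplicates are harmless)
data _⟶s_ : List RTm → List RTm → Set where
  step : ∀ {xs ys t 𝕋} → t ⟶r 𝕋 → (xs ++ t ∷ ys) ⟶s (xs ++ 𝕋 ++ ys)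

Normal : List RTm → Set
Normal 𝔽 = All (λ t → ∀ 𝕋 → ¬ (t ⟶r 𝕋)) 𝔽

_∈NF_ : RTm → RTm → Set
t ∈NF e = ∃[ 𝔽 ] (Star _⟶s_ [ e ] 𝔽 × Normal 𝔽 × Any (t ≈t_) 𝔽)

infix 4 _∈𝒯_
data _∈𝒯_ : RTm → Λ → Set where
  𝒯-var : ∀ {x} n → bag (replicate n (rvar x)) ∈𝒯 var x
  𝒯-lam : ∀ {N ts} → All (_∈𝒯 N) ts → bag (map rlam ts) ∈𝒯 lam N
  𝒯-app : ∀ {P Q s t} → s ∈𝒯 P → t ∈𝒯 Q → rapp s t ∈𝒯 app P Q

_∈NF𝒯_ : RTm → Λ → Set
t ∈NF𝒯 M = ∃[ e ] (e ∈𝒯 M × t ∈NF e)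

infix 4 _∈𝒯nf_ _∈𝒯sp_
data _∈𝒯nf_ : RTm → Λ⊥ → Set
data _∈𝒯sp_ : RTm → Λ⊥ → Set

data _∈𝒯nf_ where
  nf-var   : ∀ {x} n → bag (replicate n (rvar x)) ∈𝒯nf var x
  nf-lam   : ∀ {A ts} → All (_∈𝒯nf A) ts → bag (map rlam ts) ∈𝒯nf lam A
  nf-bot   : bag [] ∈𝒯nf bot
  nf-spine : ∀ {S t} → t ∈𝒯sp S → t ∈𝒯nf S
  nf-redex : ∀ {A S s t} → s ∈𝒯nf A → t ∈𝒯sp S →
             rapp (bag [ rlam s ]) t ∈𝒯nf app (lam A) S

data _∈𝒯sp_ where
  sp-base : ∀ {x B t} → t ∈𝒯nf B → rapp (bag [ rvar x ]) t ∈𝒯sp app (var x) B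
  sp-ext  : ∀ {S A s t} → s ∈𝒯sp S → t ∈𝒯nf A → rapp s t ∈𝒯sp app S A

_∈𝒯nfBT_ : RTm → Λ → Set
t ∈𝒯nfBT M = ∃[ A ] (A ∈𝒜 M × t ∈𝒯nf A)

_⊆≈_ : (RTm → Set) → (RTm → Set) → Set
P ⊆≈ Q = ∀ t → P t → ∃[ t' ] (t ≈t t' × Q t')

module Submission where

-- (1) The grammar of approximants only admits irreducible shapes, so every element of
-- 𝒯nf(A) is a resource normal form; it also lies in the Taylor expansion of A where ⊥
-- is expanded to the empty bag, which is monotone in ⊑ and agrees with 𝒯 on ⊥-free
-- terms.  Hence it is its own normal form and belongs to 𝒯(M).
-- (2) The expansion of A with every bag a singleton lies in 𝒯nf(A), and any element of
-- 𝒯nf(A') equal to it up to bag permutation forces A ⊑ A'; so the A' ∈ 𝒜(M) that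
-- contains it gives A ⊑ A' ⊑ N for a reduct N of M.

open import Defs
open import Data.Nat using (zero; suc)
open import Data.List using (List; []; _∷_; [_]; _++_; map; replicate)
open import Data.List.Properties using (∷-injectiveˡ)
open import Data.List.Relation.Unary.All using (All; []; _∷_)
open import Data.List.Relation.Unary.Any using (here)
open import Data.List.Relation.Binary.Permutation.Propositional using (↭-refl; ↭-sym)
open import Data.List.Relation.Binary.Permutation.Propositional.Properties
  using (↭-empty-inv; ↭-singleton-inv)
open import Data.Product using (Σ; ∃-syntax; _×_; _,_; proj₂)
open import Relation.Nullary using (¬_)
open import Relation.Binary.PropositionalEquality using (_≡_; refl; sym)
open import Relation.Binary.Construct.Closure.ReflexiveTransitive using (ε)

≈t-refl : ∀ t → t ≈t t
≈v-refl : ∀ v → v ≈v v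
≈t-refl (rapp s t) = ≈-app (≈t-refl s) (≈t-refl t)
≈t-refl (bag vs)   = ≈-bag (≈b-perm ↭-refl)
≈v-refl (rvar x)   = ≈-var
≈v-refl (rlam t)   = ≈-lam (≈t-refl t)

≈t-trans : ∀ {r s t} → r ≈t s → s ≈t t → r ≈t t
≈v-trans : ∀ {u v w} → u ≈v v → v ≈v w → u ≈v w
≈t-trans (≈-app p q) (≈-app p' q') = ≈-app (≈t-trans p p') (≈t-trans q q')
≈t-trans (≈-bag p)   (≈-bag q)     = ≈-bag (≈b-trans p q)
≈v-trans ≈-var     ≈-var     = ≈-var
≈v-trans (≈-lam p) (≈-lam q) = ≈-lam (≈t-trans p q)

≈b-empty-inv : ∀ {ws} → [] ≈b ws → ws ≡ []
≈b-empty-inv ≈b-nil          = refl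
≈b-empty-inv (≈b-perm p)     = ↭-empty-inv (↭-sym p)
≈b-empty-inv (≈b-trans p q) with ≈b-empty-inv p
... | refl = ≈b-empty-inv q

≈b-singleton-inv : ∀ {v ws} → [ v ] ≈b ws → ∃[ w ] (ws ≡ [ w ] × v ≈v w)
≈b-singleton-inv (≈b-cons e p) with ≈b-empty-inv p
... | refl = _ , refl , e
≈b-singleton-inv {v} (≈b-perm p) = v , ↭-singleton-inv (↭-sym p) , ≈v-refl v
≈b-singleton-inv (≈b-trans p q) with ≈b-singleton-inv p
... | _ , refl , e with ≈b-singleton-inv q
... | w , refl , e' = w , refl , ≈v-trans e e'

singleton≉empty : ∀ {v} → ¬ ([ v ] ≈b [])
singleton≉empty p with ≈b-singleton-inv p
... | _ , () , _

singleton≈replicate-inv : ∀ {v y} n → [ v ] ≈b replicate n (rvar y) → v ≈v rvar y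
singleton≈replicate-inv n p with ≈b-singleton-inv p
singleton≈replicate-inv (suc n) p | w , eq , e rewrite sym (∷-injectiveˡ eq) = e

singleton≈map-rlam-inv : ∀ {v} ts → [ v ] ≈b map rlam ts →
  ∃[ s ] (ts ≡ [ s ] × v ≈v rlam s)
singleton≈map-rlam-inv ts p with ≈b-singleton-inv p
singleton≈map-rlam-inv (s ∷ []) p | _ , refl , e = s , refl , e
singleton≈map-rlam-inv (_ ∷ _ ∷ _) p | _ , () , _

infix 4 _∈𝒯⊥_
data _∈𝒯⊥_ : RTm → Λ⊥ → Set where
  𝒯⊥-var : ∀ {x} n → bag (replicate n (rvar x)) ∈𝒯⊥ var x
  𝒯⊥-lam : ∀ {N ts} → All (_∈𝒯⊥ N) ts → bag (map rlam ts) ∈𝒯⊥ lam N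
  𝒯⊥-app : ∀ {P Q s t} → s ∈𝒯⊥ P → t ∈𝒯⊥ Q → rapp s t ∈𝒯⊥ app P Q
  𝒯⊥-bot : bag [] ∈𝒯⊥ bot

𝒯⊥-mono : ∀ {A N t} → A ⊑ N → t ∈𝒯⊥ A → t ∈𝒯⊥ N
𝒯⊥-mono-All : ∀ {A N ts} → A ⊑ N → All (_∈𝒯⊥ A) ts → All (_∈𝒯⊥ N) ts
𝒯⊥-mono ⊑-refl        h            = h
𝒯⊥-mono (⊑-trans p q) h            = 𝒯⊥-mono q (𝒯⊥-mono p h)
𝒯⊥-mono ⊥⊑var         𝒯⊥-bot       = 𝒯⊥-var 0
𝒯⊥-mono ⊥⊑lam         𝒯⊥-bot       = 𝒯⊥-lam []
𝒯⊥-mono (⊑-lam p)     (𝒯⊥-lam hs)  = 𝒯⊥-lam (𝒯⊥-mono-All p hs)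
𝒯⊥-mono (⊑-app p q)   (𝒯⊥-app h k) = 𝒯⊥-app (𝒯⊥-mono p h) (𝒯⊥-mono q k)
𝒯⊥-mono-All p []       = []
𝒯⊥-mono-All p (h ∷ hs) = 𝒯⊥-mono p h ∷ 𝒯⊥-mono-All p hs

𝒯nf⊆𝒯⊥ : ∀ {A t} → t ∈𝒯nf A → t ∈𝒯⊥ A
𝒯sp⊆𝒯⊥ : ∀ {S t} → t ∈𝒯sp S → t ∈𝒯⊥ S
𝒯nf⊆𝒯⊥-All : ∀ {A ts} → All (_∈𝒯nf A) ts → All (_∈𝒯⊥ A) ts
𝒯nf⊆𝒯⊥ (nf-var n)     = 𝒯⊥-var n
𝒯nf⊆𝒯⊥ (nf-lam hs)    = 𝒯⊥-lam (𝒯nf⊆𝒯⊥-All hs)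
𝒯nf⊆𝒯⊥ nf-bot         = 𝒯⊥-bot
𝒯nf⊆𝒯⊥ (nf-spine h)   = 𝒯sp⊆𝒯⊥ h
𝒯nf⊆𝒯⊥ (nf-redex h k) = 𝒯⊥-app (𝒯⊥-lam (𝒯nf⊆𝒯⊥ h ∷ [])) (𝒯sp⊆𝒯⊥ k)
𝒯sp⊆𝒯⊥ (sp-base h)    = 𝒯⊥-app (𝒯⊥-var 1) (𝒯nf⊆𝒯⊥ h)
𝒯sp⊆𝒯⊥ (sp-ext k h)   = 𝒯⊥-app (𝒯sp⊆𝒯⊥ k) (𝒯nf⊆𝒯⊥ h)
𝒯nf⊆𝒯⊥-All []       = []
𝒯nf⊆𝒯⊥-All (h ∷ hs) = 𝒯nf⊆𝒯⊥ h ∷ 𝒯nf⊆𝒯⊥-All hs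

𝒯⊥⌜⌝⇒𝒯 : ∀ M {t} → t ∈𝒯⊥ ⌜ M ⌝ → t ∈𝒯 M
𝒯⊥⌜⌝⇒𝒯-All : ∀ M {ts} → All (_∈𝒯⊥ ⌜ M ⌝) ts → All (_∈𝒯 M) ts
𝒯⊥⌜⌝⇒𝒯 (var x)   (𝒯⊥-var n)   = 𝒯-var n
𝒯⊥⌜⌝⇒𝒯 (lam M)   (𝒯⊥-lam hs)  = 𝒯-lam (𝒯⊥⌜⌝⇒𝒯-All M hs)
𝒯⊥⌜⌝⇒𝒯 (app M N) (𝒯⊥-app h k) = 𝒯-app (𝒯⊥⌜⌝⇒𝒯 M h) (𝒯⊥⌜⌝⇒𝒯 N k)
𝒯⊥⌜⌝⇒𝒯-All M []       = []
𝒯⊥⌜⌝⇒𝒯-All M (h ∷ hs) = 𝒯⊥⌜⌝⇒𝒯 M h ∷ 𝒯⊥⌜⌝⇒𝒯-All M hs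

𝒯nf-⊑⇒𝒯 : ∀ {A M t} → A ⊑ ⌜ M ⌝ → t ∈𝒯nf A → t ∈𝒯 M
𝒯nf-⊑⇒𝒯 {M = M} A⊑M h = 𝒯⊥⌜⌝⇒𝒯 M (𝒯⊥-mono A⊑M (𝒯nf⊆𝒯⊥ h))

data IsNF : RTm → Set
data IsNFB : RTm → Set
data IsNFSpine : RTm → Set
data IsNFVal : RVal → Set

data IsNFVal where
  nf-rvar : ∀ {x} → IsNFVal (rvar x)
  nf-rlam : ∀ {t} → IsNF t → IsNFVal (rlam t)

data IsNFB where
  nfB-bag   : ∀ {vs} → All IsNFVal vs → IsNFB (bag vs)
  nfB-spine : ∀ {t} → IsNFSpine t → IsNFB t

data IsNFSpine where
  nfsp-base : ∀ {x u} → IsNFB u → IsNFSpine (rapp (bag [ rvar x ]) u)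
  nfsp-ext  : ∀ {s u} → IsNFSpine s → IsNF u → IsNFSpine (rapp s u)

data IsNF where
  nf-B     : ∀ {t} → IsNFB t → IsNF t
  nf-redex : ∀ {s u} → IsNF s → IsNFSpine u → IsNF (rapp (bag [ rlam s ]) u)

Irreducible : RTm → Set
Irreducible t = ∀ 𝕋 → ¬ (t ⟶r 𝕋)

bag-⟶r-inv : ∀ {vs 𝕋} → bag vs ⟶r 𝕋 →
  Σ (List RVal) λ us → Σ (List RVal) λ ws → Σ RTm λ t → Σ (List RTm) λ 𝕋' →
    vs ≡ us ++ rlam t ∷ ws × t ⟶r 𝕋'
bag-⟶r-inv (ξbag {vs} {ws} {t} {𝕋} r) = vs , ws , t , 𝕋 , refl , r

[rlam]-⟶r-inv : ∀ {s 𝕊} → bag [ rlam s ] ⟶r 𝕊 → Σ (List RTm) λ 𝕊' → s ⟶r 𝕊'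
[rlam]-⟶r-inv r with bag-⟶r-inv r
... | []        , _ , _ , 𝕊' , refl , r' = 𝕊' , r'
... | _ ∷ []    , _ , _ , _  , ()   , _
... | _ ∷ _ ∷ _ , _ , _ , _  , ()   , _

[rvar]-irreducible : ∀ {x} → Irreducible (bag [ rvar x ])
[rvar]-irreducible _ r with bag-⟶r-inv r
... | []        , _ , _ , _ , () , _
... | _ ∷ []    , _ , _ , _ , () , _
... | _ ∷ _ ∷ _ , _ , _ , _ , () , _

IsNF⇒irreducible : ∀ {t} → IsNF t → Irreducible t
IsNFB⇒irreducible : ∀ {t} → IsNFB t → Irreducible t
IsNFSpine⇒irreducible : ∀ {t} → IsNFSpine t → Irreducible t
All-IsNFVal⇒irreducible : ∀ us {t ws 𝕋} →
  All IsNFVal (us ++ rlam t ∷ ws) → ¬ (t ⟶r 𝕋)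

All-IsNFVal⇒irreducible []       (nf-rlam n ∷ _) r = IsNF⇒irreducible n _ r
All-IsNFVal⇒irreducible (_ ∷ us) (_ ∷ ns)        r = All-IsNFVal⇒irreducible us ns r

IsNFB⇒irreducible (nfB-bag ns)   _ (ξbag {vs} r) = All-IsNFVal⇒irreducible vs ns r
IsNFB⇒irreducible (nfB-spine n) 𝕋 r             = IsNFSpine⇒irreducible n 𝕋 r

IsNF⇒irreducible (nf-B n)                    𝕋 r      = IsNFB⇒irreducible n 𝕋 r
IsNF⇒irreducible (nf-redex _ ())             _ βr
IsNF⇒irreducible (nf-redex _ _)              _ (r0 ne) = ne refl
IsNF⇒irreducible (nf-redex _ (nfsp-ext () _)) _ rσ₃
IsNF⇒irreducible (nf-redex n _)              _ (ξl r) =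
  IsNF⇒irreducible n _ (proj₂ ([rlam]-⟶r-inv r))
IsNF⇒irreducible (nf-redex _ u)              _ (ξr r) = IsNFSpine⇒irreducible u _ r

IsNFSpine⇒irreducible (nfsp-base _)                          _ (r0 ne) = ne refl
IsNFSpine⇒irreducible (nfsp-base (nfB-spine (nfsp-ext () _))) _ rσ₃
IsNFSpine⇒irreducible (nfsp-base _)                          _ (ξl r)  = [rvar]-irreducible _ r
IsNFSpine⇒irreducible (nfsp-base n)                          _ (ξr r)  = IsNFB⇒irreducible n _ r
IsNFSpine⇒irreducible (nfsp-ext () _)                        _ βr
IsNFSpine⇒irreducible (nfsp-ext () _)                        _ (r0 _)
IsNFSpine⇒irreducible (nfsp-ext (nfsp-ext () _) _)           _ rσ₁
IsNFSpine⇒irreducible (nfsp-ext () _)                        _ rσ₃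
IsNFSpine⇒irreducible (nfsp-ext s _)                         _ (ξl r)  = IsNFSpine⇒irreducible s _ r
IsNFSpine⇒irreducible (nfsp-ext _ u)                         _ (ξr r)  = IsNF⇒irreducible u _ r

irreducible⇒∈NF : ∀ {t} → Irreducible t → t ∈NF t
irreducible⇒∈NF {t} irr = [ t ] , ε , (irr ∷ []) , here (≈t-refl t)

replicate-IsNFVal : ∀ {x} n → All IsNFVal (replicate n (rvar x))
replicate-IsNFVal zero    = []
replicate-IsNFVal (suc n) = nf-rvar ∷ replicate-IsNFVal n

𝒯nf-IsNF : ∀ {A t} → IsA A → t ∈𝒯nf A → IsNF t
𝒯nf-IsNFB : ∀ {B t} → IsB B → t ∈𝒯nf B → IsNFB t
𝒯sp-IsNFSpine : ∀ {S t} → IsSpine S → t ∈𝒯sp S → IsNFSpine t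
𝒯nf-map-rlam-IsNFVal : ∀ {A ts} → IsA A → All (_∈𝒯nf A) ts → All IsNFVal (map rlam ts)
𝒯nf-IsNF (A-B b) h = nf-B (𝒯nf-IsNFB b h)
𝒯nf-IsNF (A-C (C-redex _ _)) (nf-spine (sp-ext () _))
𝒯nf-IsNF (A-C (C-redex a s)) (nf-redex h k) = nf-redex (𝒯nf-IsNF a h) (𝒯sp-IsNFSpine s k)
𝒯nf-IsNFB B-var (nf-var n) = nfB-bag (replicate-IsNFVal n)
𝒯nf-IsNFB B-var (nf-spine ())
𝒯nf-IsNFB (B-lam a) (nf-lam hs) = nfB-bag (𝒯nf-map-rlam-IsNFVal a hs)
𝒯nf-IsNFB (B-lam _) (nf-spine ())
𝒯nf-IsNFB B-bot nf-bot = nfB-bag []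
𝒯nf-IsNFB B-bot (nf-spine ())
𝒯nf-IsNFB (B-spine s) (nf-spine k) = nfB-spine (𝒯sp-IsNFSpine s k)
𝒯nf-IsNFB (B-spine (sp-ext () _)) (nf-redex _ _)
𝒯sp-IsNFSpine (sp-base b) (sp-base h) = nfsp-base (𝒯nf-IsNFB b h)
𝒯sp-IsNFSpine (sp-base _) (sp-ext () _)
𝒯sp-IsNFSpine (sp-ext () _) (sp-base _)
𝒯sp-IsNFSpine (sp-ext s a) (sp-ext k h) = nfsp-ext (𝒯sp-IsNFSpine s k) (𝒯nf-IsNF a h)
𝒯nf-map-rlam-IsNFVal a []       = []
𝒯nf-map-rlam-IsNFVal a (h ∷ hs) = nf-rlam (𝒯nf-IsNF a h) ∷ 𝒯nf-map-rlam-IsNFVal a hs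

⊑⇒𝒯nf⊆NF𝒯 : ∀ {M A} → IsA A → A ⊑ ⌜ M ⌝ → (_∈𝒯nf A) ⊆≈ (_∈NF𝒯 M)
⊑⇒𝒯nf⊆NF𝒯 isA A⊑M t h =
  t , ≈t-refl t , t , 𝒯nf-⊑⇒𝒯 A⊑M h ,
  irreducible⇒∈NF (IsNF⇒irreducible (𝒯nf-IsNF isA h))

singletonTaylor : Λ⊥ → RTm
singletonTaylor (var x)   = bag [ rvar x ]
singletonTaylor (lam A)   = bag [ rlam (singletonTaylor A) ]
singletonTaylor (app P Q) = rapp (singletonTaylor P) (singletonTaylor Q)
singletonTaylor bot       = bag []

singletonTaylor-∈𝒯nf : ∀ {A} → IsA A → singletonTaylor A ∈𝒯nf A
singletonTaylor-∈𝒯nf-B : ∀ {B} → IsB B → singletonTaylor B ∈𝒯nf B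
singletonTaylor-∈𝒯sp : ∀ {S} → IsSpine S → singletonTaylor S ∈𝒯sp S
singletonTaylor-∈𝒯nf (A-B b)             = singletonTaylor-∈𝒯nf-B b
singletonTaylor-∈𝒯nf (A-C (C-redex a s)) =
  nf-redex (singletonTaylor-∈𝒯nf a) (singletonTaylor-∈𝒯sp s)
singletonTaylor-∈𝒯nf-B B-var       = nf-var 1
singletonTaylor-∈𝒯nf-B (B-lam a)   = nf-lam (singletonTaylor-∈𝒯nf a ∷ [])
singletonTaylor-∈𝒯nf-B B-bot       = nf-bot
singletonTaylor-∈𝒯nf-B (B-spine s) = nf-spine (singletonTaylor-∈𝒯sp s)
singletonTaylor-∈𝒯sp (sp-base b)  = sp-base (singletonTaylor-∈𝒯nf-B b)
singletonTaylor-∈𝒯sp (sp-ext s a) = sp-ext (singletonTaylor-∈𝒯sp s) (singletonTaylor-∈𝒯nf a)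

singletonTaylor≈𝒯nf⇒⊑ : ∀ A {A' t} → singletonTaylor A ≈t t → t ∈𝒯nf A' → A ⊑ A'
singletonTaylor≈𝒯sp⇒⊑ : ∀ A {S t} → singletonTaylor A ≈t t → t ∈𝒯sp S → A ⊑ S
singletonTaylor≈𝒯nf⇒⊑ bot _ (nf-var _) = ⊥⊑var
singletonTaylor≈𝒯nf⇒⊑ bot _ (nf-lam _) = ⊥⊑lam
singletonTaylor≈𝒯nf⇒⊑ bot _ nf-bot     = ⊑-refl
singletonTaylor≈𝒯nf⇒⊑ (var x) (≈-bag p) (nf-var n) with singleton≈replicate-inv n p
... | ≈-var = ⊑-refl
singletonTaylor≈𝒯nf⇒⊑ (lam A) (≈-bag p) (nf-var n) with singleton≈replicate-inv n p
... | ()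
singletonTaylor≈𝒯nf⇒⊑ (var x) (≈-bag p) (nf-lam {ts = ts} _) with singleton≈map-rlam-inv ts p
... | _ , refl , ()
singletonTaylor≈𝒯nf⇒⊑ (lam A) (≈-bag p) (nf-lam {ts = ts} hs) with singleton≈map-rlam-inv ts p
singletonTaylor≈𝒯nf⇒⊑ (lam A) (≈-bag p) (nf-lam (h ∷ [])) | _ , refl , ≈-lam e =
  ⊑-lam (singletonTaylor≈𝒯nf⇒⊑ A e h)
singletonTaylor≈𝒯nf⇒⊑ (var x) (≈-bag p) nf-bot with singleton≉empty p
... | ()
singletonTaylor≈𝒯nf⇒⊑ (lam A) (≈-bag p) nf-bot with singleton≉empty p
... | ()
singletonTaylor≈𝒯nf⇒⊑ A e (nf-spine k) = singletonTaylor≈𝒯sp⇒⊑ A e k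
singletonTaylor≈𝒯nf⇒⊑ (app P Q) (≈-app e e') (nf-redex h k) =
  ⊑-app (singletonTaylor≈𝒯nf⇒⊑ P e (nf-lam (h ∷ []))) (singletonTaylor≈𝒯sp⇒⊑ Q e' k)
singletonTaylor≈𝒯sp⇒⊑ (app P Q) (≈-app e e') (sp-base h) =
  ⊑-app (singletonTaylor≈𝒯nf⇒⊑ P e (nf-var 1)) (singletonTaylor≈𝒯nf⇒⊑ Q e' h)
singletonTaylor≈𝒯sp⇒⊑ (app P Q) (≈-app e e') (sp-ext k h) =
  ⊑-app (singletonTaylor≈𝒯sp⇒⊑ P e k) (singletonTaylor≈𝒯nf⇒⊑ Q e' h)

𝒯nf⊆𝒯nfBT⇒∈𝒜 : ∀ {M A} → IsA A → (_∈𝒯nf A) ⊆≈ (_∈𝒯nfBT M) → A ∈𝒜 M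
𝒯nf⊆𝒯nfBT⇒∈𝒜 {A = A} isA incl
  with incl (singletonTaylor A) (singletonTaylor-∈𝒯nf isA)
... | _ , e , _ , (_ , N , M↠N , A'⊑N) , h =
  isA , N , M↠N , ⊑-trans (singletonTaylor≈𝒯nf⇒⊑ A e h) A'⊑N

lemma4p10 : (M : Λ) (A : Λ⊥) → IsA A →
    (A ⊑ ⌜ M ⌝ → (_∈𝒯nf A) ⊆≈ (_∈NF𝒯 M))
    × ((_∈𝒯nf A) ⊆≈ (_∈𝒯nfBT M) → A ∈𝒜 M)
lemma4p10 M A isA = ⊑⇒𝒯nf⊆NF𝒯 isA , 𝒯nf⊆𝒯nfBT⇒∈𝒜 isA
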